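{- Let $W$ be a finite Coxeter group. For every word $\mathbf{w}$ in the simple reflections and all $u,v\in W$, $R^{(v)}_{u,\mathbf{w}}(q)=q^{\ell(v)}\,\tau^-(T_{v^{ -1}}^{ -1}T_{\mathbf{w}}T_{vu}^{ -1})$.
   Context: $\mathcal{H}_W$ is the $\mathbb{Z}[q^{\pm1}]$-algebra with basis $\{T_w\}$ and relations $T_wT_s=qT_{ws}+(q-1)T_w$ if $\ell(ws)<\ell(w)$, $T_wT_s=T_{ws}$ otherwise; $T_{\mathbf{w}}=T_{s_1}\cdots T_{s_m}$. $\tau^-:\mathcal{H}_W\to\mathbb{Z}[q^{\pm1}]$ is the $\mathbb{Z}[q^{\pm1}]$-linear map with $\tau^-(T_w^{ -1})=1$ if $w=e$ and $0$ otherwise (for the basis $\{T_w^{ -1}\}$). $R^{(v)}_{u,\varnothing}=\delta_{u,e}$; $R^{(v)}_{u,\mathbf{w}\mathbf{s}}=R^{(v)}_{us,\mathbf{w}}$ if $\ell(vus)<\ell(vu)$, and $=qR^{(v)}_{us,\mathbf{w}}+(q-1)R^{(v)}_{u,\mathbf{w}}$ if $\ell(vus)>\ell(vu)$. -}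

module Defs where

open import Level using (0ℓ)
open import Data.Bool using (Bool; true; false; if_then_else_)
open import Data.Nat as ℕ using (ℕ; zero; suc; _≤_; _<_; _<?_)
open import Data.Integer as ℤ using (ℤ; +_; -[1+_])
open import Data.List using (List; []; _∷_; length; replicate; _++_; reverse; map)
open import Data.Fin as Fin using (Fin)
open import Data.Product using (Σ; Σ-syntax; _×_; _,_)
open import Relation.Nullary using (¬_; does; yes; no)
open import Relation.Binary.PropositionalEquality using (_≡_)
open import Relation.Binary.Structures using (IsEquivalence)
open import Algebra.Bundles using (Group)

-- Laurent polynomials ℤ[q, q⁻¹]
-- laurent k [c₀, c₁, …] represents q^k (c₀ + c₁ q + c₂ q² + …).
-- Equality is coefficientwise (≈L).

record Laurent : Set where
  constructor laurent
  field
    shift  : ℤ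
    coeffs : List ℤ

nthℤ : List ℤ → ℕ → ℤ
nthℤ []       _       = + 0
nthℤ (c ∷ cs) zero    = c
nthℤ (c ∷ cs) (suc n) = nthℤ cs n

coeff : Laurent → ℤ → ℤ
coeff (laurent k cs) n with n ℤ.- k
... | + d      = nthℤ cs d
... | -[1+ _ ] = + 0

infix 4 _≈L_
_≈L_ : Laurent → Laurent → Set
p ≈L p' = ∀ n → coeff p n ≡ coeff p' n

addList : List ℤ → List ℤ → List ℤ
addList []       ys       = ys
addList (x ∷ xs) []       = x ∷ xs
addList (x ∷ xs) (y ∷ ys) = (x ℤ.+ y) ∷ addList xs ys

mulList : List ℤ → List ℤ → List ℤ
mulList []       ys = []
mulList (x ∷ xs) ys = addList (map (x ℤ.*_) ys) (+ 0 ∷ mulList xs ys)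

pad : ℕ → List ℤ → List ℤ
pad k cs = replicate k (+ 0) ++ cs

infixl 6 _+L_ _-L_
infixl 7 _*L_

_+L_ : Laurent → Laurent → Laurent
laurent k cs +L laurent k' cs' =
  laurent m (addList (pad ℤ.∣ k ℤ.- m ∣ cs) (pad ℤ.∣ k' ℤ.- m ∣ cs'))
  where m = k ℤ.⊓ k'

_*L_ : Laurent → Laurent → Laurent
laurent k cs *L laurent k' cs' = laurent (k ℤ.+ k') (mulList cs cs')

-L_ : Laurent → Laurent
-L laurent k cs = laurent k (map ℤ.-_ cs)

_-L_ : Laurent → Laurent → Laurent
p -L p' = p +L (-L p')

0L 1L q : Laurent
0L = laurent (+ 0) []
1L = laurent (+ 0) (+ 1 ∷ [])
q  = laurent (+ 1) (+ 1 ∷ [])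

q^ : ℕ → Laurent
q^ n = laurent (+ n) (+ 1 ∷ [])

sumFin : {A : Set} → (A → A → A) → A → (n : ℕ) → (Fin n → A) → A
sumFin _⊕_ z zero    f = z
sumFin _⊕_ z (suc n) f = f Fin.zero ⊕ sumFin _⊕_ z n (λ k → f (Fin.suc k))

gpow : (G : Group 0ℓ 0ℓ) → Group.Carrier G → ℕ → Group.Carrier G
gpow G x zero    = Group.ε G
gpow G x (suc n) = Group._∙_ G x (gpow G x n)

wprod : {W : Set} {r : ℕ} → (W → W → W) → W → (Fin r → W) → List (Fin r) → W
wprod _·_ e s []      = e
wprod _·_ e s (i ∷ w) = s i · wprod _·_ e s w

wpow : {W : Set} → (W → W → W) → W → W → ℕ → W
wpow _·_ e x zero    = e
wpow _·_ e x (suc n) = x · wpow _·_ e x n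

record CoxeterSystem : Set₁ where
  infixl 7 _·_
  field
    W   : Set
    _·_ : W → W → W
    e   : W
    _⁻¹ : W → W
    ·-assoc   : ∀ x y z → (x · y) · z ≡ x · (y · z)
    ·-idˡ     : ∀ x → e · x ≡ x
    ·-idʳ     : ∀ x → x · e ≡ x
    ·-invˡ    : ∀ x → (x ⁻¹) · x ≡ e
    ·-invʳ    : ∀ x → x · (x ⁻¹) ≡ e
    N         : ℕ
    enum      : Fin N → W
    index     : W → Fin N
    enum-index : ∀ w → enum (index w) ≡ w
    index-enum : ∀ k → index (enum k) ≡ k
    r         : ℕ
    s         : Fin r → W
    m         : Fin r → Fin r → ℕ
    m-diag    : ∀ i → m i i ≡ 1
    m-sym     : ∀ i j → m i j ≡ m j i
    m-off     : ∀ i j → ¬ (i ≡ j) → 2 ≤ m i j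

    relations : ∀ i j → wpow _·_ e (s i · s j) (m i j) ≡ e
    generated : ∀ w → Σ[ word ∈ List (Fin r) ] wprod _·_ e s word ≡ w
    presented : (G : Group 0ℓ 0ℓ) (g : Fin r → Group.Carrier G) →
                (∀ i j → Group._≈_ G (gpow G (Group._∙_ G (g i) (g j)) (m i j)) (Group.ε G)) →
                Σ[ φ ∈ (W → Group.Carrier G) ]
                  ((∀ x y → Group._≈_ G (φ (x · y)) (Group._∙_ G (φ x) (φ y))) ×
                   (∀ i → Group._≈_ G (φ (s i)) (g i)))
    ℓ         : W → ℕ
    ℓ-word    : ∀ w → Σ[ word ∈ List (Fin r) ] (length word ≡ ℓ w × wprod _·_ e s word ≡ w)
    ℓ-min     : ∀ w (word : List (Fin r)) → wprod _·_ e s word ≡ w → ℓ w ≤ length word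

  isE : W → Bool
  isE u = does (index u Fin.≟ index e)

module _ (C : CoxeterSystem) where
  open CoxeterSystem C

  -- Rrev v u ρ = R^{(v)}_{u, reverse ρ}: the head of ρ is the LAST letter.
  Rrev : W → W → List (Fin r) → Laurent
  Rrev v u []      = if isE u then 1L else 0L
  Rrev v u (i ∷ ρ) with ℓ (v · u · s i) <? ℓ (v · u)
  ... | yes _ = Rrev v (u · s i) ρ
  ... | no  _ = (q *L Rrev v (u · s i) ρ) +L ((q -L 1L) *L Rrev v u ρ)

  Rpoly : W → W → List (Fin r) → Laurent
  Rpoly v u w = Rrev v u (reverse w)

record HeckeAlgebra (C : CoxeterSystem) : Set₁ where
  open CoxeterSystem C
  infix  4 _≈_
  infixl 6 _+H_
  infixl 7 _*H_
  infixr 8 _•_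
  field
    H     : Set
    _≈_   : H → H → Set
    ≈-equiv : IsEquivalence _≈_
    _+H_  : H → H → H
    _*H_  : H → H → H
    _•_   : Laurent → H → H
    0H    : H
    1H    : H
    +-cong : ∀ {x x' y y'} → x ≈ x' → y ≈ y' → x +H y ≈ x' +H y'
    *-cong : ∀ {x x' y y'} → x ≈ x' → y ≈ y' → x *H y ≈ x' *H y'
    •-cong : ∀ {a a' x x'} → a ≈L a' → x ≈ x' → a • x ≈ a' • x'
    +-assoc : ∀ x y z → (x +H y) +H z ≈ x +H (y +H z)
    +-comm  : ∀ x y → x +H y ≈ y +H x
    +-idˡ   : ∀ x → 0H +H x ≈ x
    *-assoc : ∀ x y z → (x *H y) *H z ≈ x *H (y *H z)
    *-idˡ   : ∀ x → 1H *H x ≈ x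
    *-idʳ   : ∀ x → x *H 1H ≈ x
    distribˡ : ∀ x y z → x *H (y +H z) ≈ (x *H y) +H (x *H z)
    distribʳ : ∀ x y z → (y +H z) *H x ≈ (y *H x) +H (z *H x)
    •-distribʳ : ∀ a b x → (a +L b) • x ≈ (a • x) +H (b • x)
    •-distribˡ : ∀ a x y → a • (x +H y) ≈ (a • x) +H (a • y)
    •-assoc  : ∀ a b x → (a *L b) • x ≈ a • (b • x)
    •-one    : ∀ x → 1L • x ≈ x
    •-zero   : ∀ x → 0L • x ≈ 0H
    •-*ˡ     : ∀ a x y → (a • x) *H y ≈ a • (x *H y)
    •-*ʳ     : ∀ a x y → x *H (a • y) ≈ a • (x *H y)
    T       : W → H
    T-e     : T e ≈ 1H
    T-down  : ∀ w i → ℓ (w · s i) < ℓ w →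
              T w *H T (s i) ≈ (q • T (w · s i)) +H ((q -L 1L) • T w)
    T-up    : ∀ w i → ¬ (ℓ (w · s i) < ℓ w) → T w *H T (s i) ≈ T (w · s i)
    T-span  : ∀ x → Σ[ c ∈ (Fin N → Laurent) ]
                x ≈ sumFin _+H_ 0H N (λ k → c k • T (enum k))
    T-indep : ∀ (c : Fin N → Laurent) →
                sumFin _+H_ 0H N (λ k → c k • T (enum k)) ≈ 0H →
                ∀ k → c k ≈L 0L

  Tword : List (Fin r) → H
  Tword []      = 1H
  Tword (i ∷ w) = T (s i) *H Tword w

  IsInverseFamily : (W → H) → Set
  IsInverseFamily Ti = ∀ w → (T w *H Ti w ≈ 1H) × (Ti w *H T w ≈ 1H)

  IsTauMinus : (W → H) → (H → Laurent) → Set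
  IsTauMinus Ti τ =
    (∀ {x y} → x ≈ y → τ x ≈L τ y) ×
    (∀ x y → τ (x +H y) ≈L τ x +L τ y) ×
    (∀ a x → τ (a • x) ≈L a *L τ x) ×
    (∀ w → τ (Ti w) ≈L (if isE w then 1L else 0L))

module Submission where

-- Fix v and read 𝐰 from the right. Multiplying by T_s on the left of T_x⁻¹ gives
-- T_s T_x⁻¹ = T_{xs}⁻¹ if ℓ(xs) < ℓ(x), and q T_{xs}⁻¹ + (q - 1) T_x⁻¹ otherwise, so
-- 𝐰 ↦ τ⁻(q^ℓ(v) T_{v⁻¹}⁻¹ T_𝐰 T_{vu}⁻¹) obeys the defining recursion of R^{(v)}_{u,𝐰}.
-- For the empty word this is the duality τ⁻(q^ℓ(a) T_a⁻¹ T_y⁻¹) = δ_{ay,e}, proved by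
-- induction along a reduced word of a, using the quadratic relation
-- q (T_s⁻¹)² + (q - 1) T_s⁻¹ = 1 when ℓ(ys) < ℓ(y).

open import Defs
open import Level using (0ℓ)
open import Algebra.Bundles using (Group; CommutativeRing)
open import Data.Bool using (true; false; if_then_else_)
open import Data.Bool.Properties using (xor-∧-commutativeRing; xor-same)
open import Data.Empty using (⊥-elim)
open import Data.Fin as Fin using (Fin)
open import Data.Integer as ℤ using (ℤ; +_; -[1+_])
import Data.Integer.Properties as ℤP
open import Data.Integer.Tactic.RingSolver using (solve-∀)
open import Data.List using (List; []; _∷_; length; map; _++_; [_]; reverse)
import Data.List.Properties as ListP
open import Data.Nat as ℕ using (zero; suc)
import Data.Nat.Properties as ℕP
open import Data.Product using (_,_; proj₁; proj₂)
open import Relation.Binary.Bundles using (Setoid)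
open import Relation.Binary.PropositionalEquality hiding ([_])
open import Relation.Binary.Structures using (IsEquivalence)
import Relation.Binary.Reasoning.Setoid as SetoidReasoning
open import Relation.Nullary using (¬_; yes; no; contradiction)

coeffAt : List ℤ → ℤ → ℤ
coeffAt cs (+ d)    = nthℤ cs d
coeffAt cs -[1+ _ ] = + 0

coeff-laurent : ∀ k cs n → coeff (laurent k cs) n ≡ coeffAt cs (n ℤ.- k)
coeff-laurent k cs n with n ℤ.- k
... | + d      = refl
... | -[1+ _ ] = refl

coeffAt-[] : ∀ z → coeffAt [] z ≡ + 0
coeffAt-[] (+ d)    = refl
coeffAt-[] -[1+ _ ] = refl

coeffAt-0∷ : ∀ cs z → coeffAt (+ 0 ∷ cs) z ≡ coeffAt cs (z ℤ.- + 1)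
coeffAt-0∷ cs (+ zero)  = refl
coeffAt-0∷ cs (+ suc d) = refl
coeffAt-0∷ cs -[1+ _ ]  = refl

coeffAt-pad : ∀ a cs z → coeffAt (pad a cs) z ≡ coeffAt cs (z ℤ.- + a)
coeffAt-pad zero    cs z = cong (coeffAt cs) (sym (ℤP.+-identityʳ z))
coeffAt-pad (suc a) cs z = begin
  coeffAt (+ 0 ∷ pad a cs) z           ≡⟨ coeffAt-0∷ (pad a cs) z ⟩
  coeffAt (pad a cs) (z ℤ.- + 1)       ≡⟨ coeffAt-pad a cs (z ℤ.- + 1) ⟩
  coeffAt cs (z ℤ.- + 1 ℤ.- + a)       ≡⟨ cong (coeffAt cs) (shift-twice z (+ a)) ⟩
  coeffAt cs (z ℤ.- (+ 1 ℤ.+ + a))     ∎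
  where
  open ≡-Reasoning
  shift-twice : ∀ z a → z ℤ.- + 1 ℤ.- a ≡ z ℤ.- (+ 1 ℤ.+ a)
  shift-twice = solve-∀

coeffAt-addList : ∀ cs ds z → coeffAt (addList cs ds) z ≡ coeffAt cs z ℤ.+ coeffAt ds z
coeffAt-addList cs ds -[1+ _ ] = refl
coeffAt-addList []       ds       (+ d)     = sym (ℤP.+-identityˡ _)
coeffAt-addList (c ∷ cs) []       (+ d)     = sym (ℤP.+-identityʳ _)
coeffAt-addList (c ∷ cs) (d ∷ ds) (+ zero)  = refl
coeffAt-addList (c ∷ cs) (d ∷ ds) (+ suc n) = coeffAt-addList cs ds (+ n)

coeffAt-map-* : ∀ c cs z → coeffAt (map (c ℤ.*_) cs) z ≡ c ℤ.* coeffAt cs z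
coeffAt-map-* c cs       -[1+ _ ]  = sym (ℤP.*-zeroʳ c)
coeffAt-map-* c []       (+ d)     = sym (ℤP.*-zeroʳ c)
coeffAt-map-* c (x ∷ cs) (+ zero)  = refl
coeffAt-map-* c (x ∷ cs) (+ suc d) = coeffAt-map-* c cs (+ d)

coeff-0L : ∀ n → coeff 0L n ≡ + 0
coeff-0L n = trans (coeff-laurent (+ 0) [] n) (coeffAt-[] (n ℤ.- + 0))

coeff-+L : ∀ p p' n → coeff (p +L p') n ≡ coeff p n ℤ.+ coeff p' n
coeff-+L (laurent k cs) (laurent k' cs') n = begin
  coeff (laurent k cs +L laurent k' cs') n
    ≡⟨ coeff-laurent m _ n ⟩
  coeffAt (addList (pad ∣ k - m ∣ cs) (pad ∣ k' - m ∣ cs')) (n - m)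
    ≡⟨ coeffAt-addList (pad ∣ k - m ∣ cs) (pad ∣ k' - m ∣ cs') (n - m) ⟩
  coeffAt (pad ∣ k - m ∣ cs) (n - m) + coeffAt (pad ∣ k' - m ∣ cs') (n - m)
    ≡⟨ cong₂ _+_ (padded k cs (ℤP.i⊓j≤i k k')) (padded k' cs' (ℤP.i⊓j≤j k k')) ⟩
  coeff (laurent k cs) n + coeff (laurent k' cs') n
    ∎
  where
  open ≡-Reasoning
  open import Data.Integer using (_-_; _+_; ∣_∣; _≤_)
  m = k ℤ.⊓ k'
  realign : ∀ n m k → n - m - (k - m) ≡ n - k
  realign = solve-∀
  padded : ∀ j ds → m ≤ j → coeffAt (pad ∣ j - m ∣ ds) (n - m) ≡ coeff (laurent j ds) n
  padded j ds m≤j = begin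
    coeffAt (pad ∣ j - m ∣ ds) (n - m)   ≡⟨ coeffAt-pad ∣ j - m ∣ ds (n - m) ⟩
    coeffAt ds (n - m - + ∣ j - m ∣)     ≡⟨ cong (λ t → coeffAt ds (n - m - t)) (ℤP.0≤i⇒+∣i∣≡i (ℤP.i≤j⇒0≤j-i m≤j)) ⟩
    coeffAt ds (n - m - (j - m))         ≡⟨ cong (coeffAt ds) (realign n m j) ⟩
    coeffAt ds (n - j)                   ≡⟨ coeff-laurent j ds n ⟨
    coeff (laurent j ds) n               ∎

convolution : List ℤ → ℤ → (ℤ → ℤ) → ℤ → ℤ
convolution []       k f n = + 0
convolution (c ∷ cs) k f n = c ℤ.* f (n ℤ.- k) ℤ.+ convolution cs (k ℤ.+ + 1) f n

convolution-cong : ∀ cs k {f g} → (∀ m → f m ≡ g m) → ∀ n → convolution cs k f n ≡ convolution cs k g n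
convolution-cong []       k f≗g n = refl
convolution-cong (c ∷ cs) k f≗g n = cong₂ ℤ._+_ (cong (c ℤ.*_) (f≗g _)) (convolution-cong cs _ f≗g n)

convolution-zero : ∀ cs k n → convolution cs k (λ _ → + 0) n ≡ + 0
convolution-zero []       k n = refl
convolution-zero (c ∷ cs) k n = cong₂ ℤ._+_ (ℤP.*-zeroʳ c) (convolution-zero cs _ n)

coeff-*L : ∀ k cs p n → coeff (laurent k cs *L p) n ≡ convolution cs k (coeff p) n
coeff-*L k []       (laurent k' ds) n = trans (coeff-laurent (k + k') [] n) (coeffAt-[] (n ℤ.- (k + k')))
  where open import Data.Integer using (_+_)
coeff-*L k (c ∷ cs) (laurent k' ds) n = begin
  coeff (laurent k (c ∷ cs) *L laurent k' ds) n
    ≡⟨ coeff-laurent (k + k') _ n ⟩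
  coeffAt (addList (map (c *_) ds) (+ 0 ∷ mulList cs ds)) z
    ≡⟨ coeffAt-addList (map (c *_) ds) _ z ⟩
  coeffAt (map (c *_) ds) z + coeffAt (+ 0 ∷ mulList cs ds) z
    ≡⟨ cong₂ _+_ (coeffAt-map-* c ds z) (coeffAt-0∷ (mulList cs ds) z) ⟩
  c * coeffAt ds z + coeffAt (mulList cs ds) (z - + 1)
    ≡⟨ cong₂ (λ i j → c * coeffAt ds i + coeffAt (mulList cs ds) j) (shift₁ n k k') (shift₂ n k k') ⟩
  c * coeffAt ds (n - k - k') + coeffAt (mulList cs ds) (n - ((k + + 1) + k'))
    ≡⟨ cong₂ (λ i j → c * i + j) (coeff-laurent k' ds (n - k)) (coeff-laurent ((k + + 1) + k') _ n) ⟨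
  c * coeff (laurent k' ds) (n - k) + coeff (laurent (k + + 1) cs *L laurent k' ds) n
    ≡⟨ cong (λ t → c * coeff (laurent k' ds) (n - k) + t) (coeff-*L (k + + 1) cs (laurent k' ds) n) ⟩
  convolution (c ∷ cs) k (coeff (laurent k' ds)) n
    ∎
  where
  open ≡-Reasoning
  open import Data.Integer using (_-_; _+_; _*_)
  z = n - (k + k')
  shift₁ : ∀ n k k' → n - (k + k') ≡ n - k - k'
  shift₁ = solve-∀
  shift₂ : ∀ n k k' → n - (k + k') - + 1 ≡ n - ((k + + 1) + k')
  shift₂ = solve-∀

≈L-setoid : Setoid _ _
≈L-setoid = record
  { Carrier       = Laurent
  ; _≈_           = _≈L_
  ; isEquivalence = record
    { refl  = λ _ → refl
    ; sym   = λ p≈p' n → sym (p≈p' n)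
    ; trans = λ p≈p' p'≈p'' n → trans (p≈p' n) (p'≈p'' n)
    }
  }

+L-cong : ∀ {a a' b b'} → a ≈L a' → b ≈L b' → a +L b ≈L a' +L b'
+L-cong {a} {a'} {b} {b'} a≈a' b≈b' n =
  trans (coeff-+L a b n) (trans (cong₂ ℤ._+_ (a≈a' n) (b≈b' n)) (sym (coeff-+L a' b' n)))

+L-identityʳ : ∀ a → a +L 0L ≈L a
+L-identityʳ a n = trans (coeff-+L a 0L n) (trans (cong (λ t → coeff a n ℤ.+ t) (coeff-0L n)) (ℤP.+-identityʳ (coeff a n)))

*L-congˡ : ∀ a {b b'} → b ≈L b' → a *L b ≈L a *L b'
*L-congˡ (laurent k cs) {b} {b'} b≈b' n =
  trans (coeff-*L k cs b n) (trans (convolution-cong cs k b≈b' n) (sym (coeff-*L k cs b' n)))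

*L-zeroʳ : ∀ a → a *L 0L ≈L 0L
*L-zeroʳ (laurent k cs) n = begin
  coeff (laurent k cs *L 0L) n   ≡⟨ coeff-*L k cs 0L n ⟩
  convolution cs k (coeff 0L) n  ≡⟨ convolution-cong cs k coeff-0L n ⟩
  convolution cs k _ n           ≡⟨ convolution-zero cs k n ⟩
  + 0                            ≡⟨ coeff-0L n ⟨
  coeff 0L n                     ∎
  where open ≡-Reasoning

module ≈L-Reasoning = SetoidReasoning ≈L-setoid

ℤ₂ : Group 0ℓ 0ℓ
ℤ₂ = CommutativeRing.+-group xor-∧-commutativeRing

ℤ₂-pow-false : ∀ n → gpow ℤ₂ false n ≡ false
ℤ₂-pow-false zero    = refl
ℤ₂-pow-false (suc n) = ℤ₂-pow-false n

module CoxeterSystemProperties (C : CoxeterSystem) where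
  open import Data.Nat using (_+_; _≤_)
  open CoxeterSystem C

  W-group : Group 0ℓ 0ℓ
  W-group = record
    { Carrier = W ; _≈_ = _≡_ ; _∙_ = _·_ ; ε = e ; _⁻¹ = _⁻¹
    ; isGroup = record
      { isMonoid = record
        { isSemigroup = record
          { isMagma = record { isEquivalence = isEquivalence ; ∙-cong = cong₂ _·_ }
          ; assoc   = ·-assoc
          }
        ; identity = ·-idˡ , ·-idʳ
        }
      ; inverse = ·-invˡ , ·-invʳ
      ; ⁻¹-cong = cong _⁻¹
      }
    }

  open import Algebra.Properties.Group W-group
    using (inverseʳ-unique; ε⁻¹≈ε; ⁻¹-anti-homo-∙; ⁻¹-involutive)

  ⟦_⟧ : List (Fin r) → W
  ⟦_⟧ = wprod _·_ e s

  Reduced : List (Fin r) → Set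
  Reduced L = ℓ ⟦ L ⟧ ≡ length L

  ·-inverse-comm : ∀ {x y} → x · y ≡ e → y · x ≡ e
  ·-inverse-comm {x} {y} xy≡e = trans (cong (_· x) (inverseʳ-unique x y xy≡e)) (·-invˡ x)

  ⁻¹-cancelˡ : ∀ x y → x ⁻¹ · (x · y) ≡ y
  ⁻¹-cancelˡ x y = trans (sym (·-assoc _ _ _)) (trans (cong (_· y) (·-invˡ x)) (·-idˡ y))

  s²≡e : ∀ i → s i · s i ≡ e
  s²≡e i = trans (sym (·-idʳ _)) (subst (λ k → wpow _·_ e (s i · s i) k ≡ e) (m-diag i) (relations i i))

  s⁻¹≡s : ∀ i → s i ⁻¹ ≡ s i
  s⁻¹≡s i = sym (inverseʳ-unique (s i) (s i) (s²≡e i))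

  ·s·s : ∀ x i → x · s i · s i ≡ x
  ·s·s x i = trans (·-assoc _ _ _) (trans (cong (x ·_) (s²≡e i)) (·-idʳ x))

  ⟦⟧-++ : ∀ L M → ⟦ L ++ M ⟧ ≡ ⟦ L ⟧ · ⟦ M ⟧
  ⟦⟧-++ []      M = sym (·-idˡ _)
  ⟦⟧-++ (i ∷ L) M = trans (cong (s i ·_) (⟦⟧-++ L M)) (sym (·-assoc _ _ _))

  ⟦⟧-reverse : ∀ L → ⟦ reverse L ⟧ ≡ ⟦ L ⟧ ⁻¹
  ⟦⟧-reverse []      = sym ε⁻¹≈ε
  ⟦⟧-reverse (i ∷ L) = begin
    ⟦ reverse (i ∷ L) ⟧     ≡⟨ cong ⟦_⟧ (ListP.unfold-reverse i L) ⟩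
    ⟦ reverse L ++ [ i ] ⟧  ≡⟨ ⟦⟧-++ (reverse L) [ i ] ⟩
    ⟦ reverse L ⟧ · ⟦ [ i ] ⟧ ≡⟨ cong₂ _·_ (⟦⟧-reverse L) (trans (·-idʳ (s i)) (sym (s⁻¹≡s i))) ⟩
    ⟦ L ⟧ ⁻¹ · s i ⁻¹       ≡⟨ ⁻¹-anti-homo-∙ (s i) ⟦ L ⟧ ⟨
    (s i · ⟦ L ⟧) ⁻¹        ∎
    where open ≡-Reasoning

  index-injective : ∀ {x y} → index x ≡ index y → x ≡ y
  index-injective {x} {y} p = trans (sym (enum-index x)) (trans (cong enum p) (enum-index y))

  isE-≢e : ∀ {x} → x ≢ e → isE x ≡ false
  isE-≢e {x} x≢e with index x Fin.≟ index e
  ... | yes x≡e = ⊥-elim (x≢e (index-injective x≡e))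
  ... | no  _ = refl

  isE-comm : ∀ x y → isE (x · y) ≡ isE (y · x)
  isE-comm x y with index (x · y) Fin.≟ index e | index (y · x) Fin.≟ index e
  ... | yes _    | yes _ = refl
  ... | no  _    | no  _ = refl
  ... | yes xy≡e | no yx≢e = ⊥-elim (yx≢e (cong index (·-inverse-comm (index-injective xy≡e))))
  ... | no xy≢e  | yes yx≡e = ⊥-elim (xy≢e (cong index (·-inverse-comm (index-injective yx≡e))))

  ℓ-⟦⟧≤ : ∀ L → ℓ ⟦ L ⟧ ≤ length L
  ℓ-⟦⟧≤ L = ℓ-min ⟦ L ⟧ L refl

  ℓ-e : ℓ e ≡ 0
  ℓ-e = ℕP.n≤0⇒n≡0 (ℓ-⟦⟧≤ [])

  ℓ≡0⇒≡e : ∀ {x} → ℓ x ≡ 0 → x ≡ e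
  ℓ≡0⇒≡e {x} ℓx≡0 with ℓ-word x
  ... | []    , _      , ⟦⟧≡x = sym ⟦⟧≡x
  ... | _ ∷ _ , |L|≡ℓx , _    = contradiction (trans |L|≡ℓx ℓx≡0) ℕP.1+n≢0

  ℓ-subadditive : ∀ x y → ℓ (x · y) ≤ ℓ x + ℓ y
  ℓ-subadditive x y with ℓ-word x | ℓ-word y
  ... | L , |L|≡ℓx , refl | M , |M|≡ℓy , refl = begin
    ℓ (⟦ L ⟧ · ⟦ M ⟧)    ≡⟨ cong ℓ (⟦⟧-++ L M) ⟨
    ℓ ⟦ L ++ M ⟧         ≤⟨ ℓ-⟦⟧≤ (L ++ M) ⟩
    length (L ++ M)      ≡⟨ ListP.length-++ L ⟩
    length L + length M  ≡⟨ cong₂ _+_ |L|≡ℓx |M|≡ℓy ⟩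
    ℓ ⟦ L ⟧ + ℓ ⟦ M ⟧    ∎
    where open ℕP.≤-Reasoning

  ℓ-⁻¹-≤ : ∀ x → ℓ (x ⁻¹) ≤ ℓ x
  ℓ-⁻¹-≤ x with ℓ-word x
  ... | L , |L|≡ℓx , refl = begin
    ℓ (⟦ L ⟧ ⁻¹)         ≡⟨ cong ℓ (⟦⟧-reverse L) ⟨
    ℓ ⟦ reverse L ⟧      ≤⟨ ℓ-⟦⟧≤ (reverse L) ⟩
    length (reverse L)   ≡⟨ ListP.length-reverse L ⟩
    length L             ≡⟨ |L|≡ℓx ⟩
    ℓ ⟦ L ⟧              ∎
    where open ℕP.≤-Reasoning

  ℓ-⁻¹ : ∀ x → ℓ (x ⁻¹) ≡ ℓ x
  ℓ-⁻¹ x = ℕP.≤-antisym (ℓ-⁻¹-≤ x) (subst (λ y → ℓ y ≤ ℓ (x ⁻¹)) (⁻¹-involutive x) (ℓ-⁻¹-≤ (x ⁻¹)))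

  -- The presentation provides the sign character W → (Bool, xor), which sends each s i to true.
  s≢e : ∀ i → s i ≢ e
  s≢e i s≡e with presented ℤ₂ (λ _ → true) (λ j k → ℤ₂-pow-false (m j k))
  ... | φ , φ-hom , φ-s = true≢false (trans (sym (φ-s i)) (trans (cong φ s≡e) φe≡false))
    where
    φe≡false : φ e ≡ false
    φe≡false = trans (trans (cong φ (sym (·-idˡ e))) (φ-hom e e)) (xor-same (φ e))
    true≢false : true ≢ false
    true≢false ()

  ℓ-s≡1 : ∀ i → ℓ (s i) ≡ 1
  ℓ-s≡1 i = ℕP.≤-antisym (ℓ-min (s i) [ i ] (·-idʳ (s i))) (ℕP.n≢0⇒n>0 (λ ℓs≡0 → s≢e i (ℓ≡0⇒≡e ℓs≡0)))

  ℓ-·s≤ : ∀ x i → ℓ (x · s i) ≤ suc (ℓ x)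
  ℓ-·s≤ x i = begin
    ℓ (x · s i)       ≤⟨ ℓ-subadditive x (s i) ⟩
    ℓ x + ℓ (s i)     ≡⟨ cong (λ k → ℓ x + k) (ℓ-s≡1 i) ⟩
    ℓ x + 1           ≡⟨ ℕP.+-comm (ℓ x) 1 ⟩
    suc (ℓ x)         ∎
    where open ℕP.≤-Reasoning

  ℓ-s·≤ : ∀ i x → ℓ (s i · x) ≤ suc (ℓ x)
  ℓ-s·≤ i x = subst (λ k → ℓ (s i · x) ≤ k + ℓ x) (ℓ-s≡1 i) (ℓ-subadditive (s i) x)

  Reduced-tail : ∀ i L → Reduced (i ∷ L) → Reduced L
  Reduced-tail i L red =
    ℕP.≤-antisym (ℓ-⟦⟧≤ L) (ℕ.s≤s⁻¹ (subst (_≤ suc (ℓ ⟦ L ⟧)) red (ℓ-s·≤ i ⟦ L ⟧)))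

  ℓ-additive-head : ∀ x i L → ℓ (x · ⟦ i ∷ L ⟧) ≡ ℓ x + length (i ∷ L) → ℓ (x · s i) ≡ suc (ℓ x)
  ℓ-additive-head x i L additive = ℕP.≤-antisym (ℓ-·s≤ x i) (ℕP.+-cancelʳ-≤ (length L) _ _ (begin
    suc (ℓ x) + length L       ≡⟨ ℕP.+-suc (ℓ x) (length L) ⟨
    ℓ x + suc (length L)       ≡⟨ additive ⟨
    ℓ (x · (s i · ⟦ L ⟧))      ≡⟨ cong ℓ (·-assoc x (s i) ⟦ L ⟧) ⟨
    ℓ (x · s i · ⟦ L ⟧)        ≤⟨ ℓ-subadditive (x · s i) ⟦ L ⟧ ⟩
    ℓ (x · s i) + ℓ ⟦ L ⟧      ≤⟨ ℕP.+-monoʳ-≤ (ℓ (x · s i)) (ℓ-⟦⟧≤ L) ⟩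
    ℓ (x · s i) + length L     ∎))
    where open ℕP.≤-Reasoning

  ℓ-additive-tail : ∀ x i L → ℓ (x · ⟦ i ∷ L ⟧) ≡ ℓ x + length (i ∷ L) →
                    ℓ (x · s i · ⟦ L ⟧) ≡ ℓ (x · s i) + length L
  ℓ-additive-tail x i L additive = begin
    ℓ (x · s i · ⟦ L ⟧)        ≡⟨ cong ℓ (·-assoc x (s i) ⟦ L ⟧) ⟩
    ℓ (x · (s i · ⟦ L ⟧))      ≡⟨ additive ⟩
    ℓ x + suc (length L)       ≡⟨ ℕP.+-suc (ℓ x) (length L) ⟩
    suc (ℓ x) + length L       ≡⟨ cong (_+ length L) (ℓ-additive-head x i L additive) ⟨
    ℓ (x · s i) + length L     ∎
    where open ≡-Reasoning

  ℓ-·s-of-inverse : ∀ {i a z} → ℓ (s i · a) ≡ suc (ℓ a) → a · z ≡ e → ℓ (z · s i) ≡ suc (ℓ z)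
  ℓ-·s-of-inverse {i} {a} {z} up az≡e rewrite inverseʳ-unique a z az≡e = begin
    ℓ (a ⁻¹ · s i)          ≡⟨ cong (λ t → ℓ (a ⁻¹ · t)) (s⁻¹≡s i) ⟨
    ℓ (a ⁻¹ · s i ⁻¹)       ≡⟨ cong ℓ (⁻¹-anti-homo-∙ (s i) a) ⟨
    ℓ ((s i · a) ⁻¹)        ≡⟨ ℓ-⁻¹ (s i · a) ⟩
    ℓ (s i · a)             ≡⟨ up ⟩
    suc (ℓ a)               ≡⟨ cong suc (ℓ-⁻¹ a) ⟨
    suc (ℓ (a ⁻¹))          ∎
    where open ≡-Reasoning

module HeckeAlgebraProperties
  (C : CoxeterSystem) (A : HeckeAlgebra C)
  (Ti : CoxeterSystem.W C → HeckeAlgebra.H A) (Ti-inverse : HeckeAlgebra.IsInverseFamily A Ti)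
  where
  open import Data.Nat using (_+_; _<_)
  open CoxeterSystem C
  open HeckeAlgebra A
  open CoxeterSystemProperties C
  open IsEquivalence ≈-equiv using () renaming (refl to ≈-refl; sym to ≈-sym; trans to ≈-trans; reflexive to ≈-reflexive)

  H-setoid : Setoid _ _
  H-setoid = record { Carrier = H ; _≈_ = _≈_ ; isEquivalence = ≈-equiv }

  module ≈H-Reasoning = SetoidReasoning H-setoid
  open ≈H-Reasoning

  T*Ti≈1 : ∀ x → T x *H Ti x ≈ 1H
  T*Ti≈1 x = proj₁ (Ti-inverse x)

  Ti*T≈1 : ∀ x → Ti x *H T x ≈ 1H
  Ti*T≈1 x = proj₂ (Ti-inverse x)

  •-congʳ : ∀ a {x y} → x ≈ y → a • x ≈ a • y
  •-congʳ a = •-cong (λ _ → refl)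

  Ti-e : Ti e ≈ 1H
  Ti-e = begin
    Ti e          ≈⟨ *-idˡ (Ti e) ⟨
    1H *H Ti e    ≈⟨ *-cong T-e ≈-refl ⟨
    T e *H Ti e   ≈⟨ T*Ti≈1 e ⟩
    1H            ∎

  Ti-anti-homo : ∀ {x y z} → T x *H T y ≈ T z → Ti z ≈ Ti y *H Ti x
  Ti-anti-homo {x} {y} {z} TxTy≈Tz = begin
    Ti z                                     ≈⟨ *-idʳ (Ti z) ⟨
    Ti z *H 1H                               ≈⟨ *-cong ≈-refl (T*Ti≈1 x) ⟨
    Ti z *H (T x *H Ti x)                    ≈⟨ *-cong ≈-refl (*-cong (*-idʳ (T x)) ≈-refl) ⟨
    Ti z *H ((T x *H 1H) *H Ti x)            ≈⟨ *-cong ≈-refl (*-cong (*-cong ≈-refl (T*Ti≈1 y)) ≈-refl) ⟨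
    Ti z *H ((T x *H (T y *H Ti y)) *H Ti x) ≈⟨ *-cong ≈-refl (*-cong (*-assoc _ _ _) ≈-refl) ⟨
    Ti z *H (((T x *H T y) *H Ti y) *H Ti x) ≈⟨ *-cong ≈-refl (*-assoc _ _ _) ⟩
    Ti z *H ((T x *H T y) *H (Ti y *H Ti x)) ≈⟨ *-assoc _ _ _ ⟨
    (Ti z *H (T x *H T y)) *H (Ti y *H Ti x) ≈⟨ *-cong (*-cong ≈-refl TxTy≈Tz) ≈-refl ⟩
    (Ti z *H T z) *H (Ti y *H Ti x)          ≈⟨ *-cong (Ti*T≈1 z) ≈-refl ⟩
    1H *H (Ti y *H Ti x)                     ≈⟨ *-idˡ _ ⟩
    Ti y *H Ti x                             ∎

  T-quadratic : ∀ i → T (s i) *H T (s i) ≈ q • 1H +H (q -L 1L) • T (s i)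
  T-quadratic i = begin
    T (s i) *H T (s i)                            ≈⟨ T-down (s i) i ℓ-ss<ℓ-s ⟩
    q • T (s i · s i) +H (q -L 1L) • T (s i)      ≈⟨ +-cong (•-congʳ q (≈-trans (≈-reflexive (cong T (s²≡e i))) T-e)) ≈-refl ⟩
    q • 1H +H (q -L 1L) • T (s i)                 ∎
    where
    ℓ-ss<ℓ-s : ℓ (s i · s i) < ℓ (s i)
    ℓ-ss<ℓ-s = subst₂ _<_ (sym (trans (cong ℓ (s²≡e i)) ℓ-e)) (sym (ℓ-s≡1 i)) (ℕP.n<1+n 0)

  T-s-via-Ti : ∀ i → T (s i) ≈ q • Ti (s i) +H (q -L 1L) • 1H
  T-s-via-Ti i = begin
    T (s i)                                                    ≈⟨ *-idʳ _ ⟨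
    T (s i) *H 1H                                              ≈⟨ *-cong ≈-refl (T*Ti≈1 (s i)) ⟨
    T (s i) *H (T (s i) *H Ti (s i))                           ≈⟨ *-assoc _ _ _ ⟨
    (T (s i) *H T (s i)) *H Ti (s i)                           ≈⟨ *-cong (T-quadratic i) ≈-refl ⟩
    (q • 1H +H (q -L 1L) • T (s i)) *H Ti (s i)                ≈⟨ distribʳ _ _ _ ⟩
    (q • 1H) *H Ti (s i) +H ((q -L 1L) • T (s i)) *H Ti (s i)  ≈⟨ +-cong (•-*ˡ _ _ _) (•-*ˡ _ _ _) ⟩
    q • (1H *H Ti (s i)) +H (q -L 1L) • (T (s i) *H Ti (s i))  ≈⟨ +-cong (•-congʳ q (*-idˡ _)) (•-congʳ (q -L 1L) (T*Ti≈1 (s i))) ⟩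
    q • Ti (s i) +H (q -L 1L) • 1H                             ∎

  Ti-quadratic : ∀ i → q • (Ti (s i) *H Ti (s i)) +H (q -L 1L) • Ti (s i) ≈ 1H
  Ti-quadratic i = begin
    q • (Ti (s i) *H Ti (s i)) +H (q -L 1L) • Ti (s i)             ≈⟨ +-cong ≈-refl (•-congʳ (q -L 1L) (*-idʳ _)) ⟨
    q • (Ti (s i) *H Ti (s i)) +H (q -L 1L) • (Ti (s i) *H 1H)     ≈⟨ +-cong (•-*ʳ _ _ _) (•-*ʳ _ _ _) ⟨
    Ti (s i) *H (q • Ti (s i)) +H Ti (s i) *H ((q -L 1L) • 1H)     ≈⟨ distribˡ _ _ _ ⟨
    Ti (s i) *H (q • Ti (s i) +H (q -L 1L) • 1H)                   ≈⟨ *-cong ≈-refl (T-s-via-Ti i) ⟨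
    Ti (s i) *H T (s i)                                            ≈⟨ Ti*T≈1 (s i) ⟩
    1H                                                             ∎

  Ti-up : ∀ y i → ¬ ℓ (y · s i) < ℓ y → Ti (s i) *H Ti y ≈ Ti (y · s i)
  Ti-up y i ys≮y = ≈-sym (Ti-anti-homo (T-up y i ys≮y))

  Ti-down : ∀ y i → ℓ (y · s i) < ℓ y → Ti (s i) *H Ti (y · s i) ≈ Ti y
  Ti-down y i ys<y = ≈-trans (Ti-up (y · s i) i yss≮ys) (≈-reflexive (cong Ti (·s·s y i)))
    where
    yss≮ys : ¬ ℓ (y · s i · s i) < ℓ (y · s i)
    yss≮ys yss<ys = ℕP.<-asym ys<y (subst (λ z → ℓ z < ℓ (y · s i)) (·s·s y i) yss<ys)

  Ti-down-expand : ∀ y i → ℓ (y · s i) < ℓ y →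
                   Ti (y · s i) ≈ q • (Ti (s i) *H Ti y) +H (q -L 1L) • Ti y
  Ti-down-expand y i ys<y = begin
    Ti (y · s i)                                                                  ≈⟨ *-idˡ _ ⟨
    1H *H Ti (y · s i)                                                            ≈⟨ *-cong (Ti-quadratic i) ≈-refl ⟨
    (q • (Ti (s i) *H Ti (s i)) +H (q -L 1L) • Ti (s i)) *H Ti (y · s i)          ≈⟨ distribʳ _ _ _ ⟩
    (q • (Ti (s i) *H Ti (s i))) *H Ti (y · s i) +H ((q -L 1L) • Ti (s i)) *H Ti (y · s i)
                                                                                  ≈⟨ +-cong (•-*ˡ _ _ _) (•-*ˡ _ _ _) ⟩
    q • ((Ti (s i) *H Ti (s i)) *H Ti (y · s i)) +H (q -L 1L) • (Ti (s i) *H Ti (y · s i))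
                                                                                  ≈⟨ +-cong (•-congʳ q (*-assoc _ _ _)) (•-congʳ (q -L 1L) (Ti-down y i ys<y)) ⟩
    q • (Ti (s i) *H (Ti (s i) *H Ti (y · s i))) +H (q -L 1L) • Ti y              ≈⟨ +-cong (•-congʳ q (*-cong ≈-refl (Ti-down y i ys<y))) ≈-refl ⟩
    q • (Ti (s i) *H Ti y) +H (q -L 1L) • Ti y                                    ∎

  T*Ti-down : ∀ x i → ℓ (x · s i) < ℓ x → T (s i) *H Ti x ≈ Ti (x · s i)
  T*Ti-down x i xs<x = begin
    T (s i) *H Ti x                          ≈⟨ *-cong ≈-refl (Ti-down x i xs<x) ⟨
    T (s i) *H (Ti (s i) *H Ti (x · s i))    ≈⟨ *-assoc _ _ _ ⟨
    (T (s i) *H Ti (s i)) *H Ti (x · s i)    ≈⟨ *-cong (T*Ti≈1 (s i)) ≈-refl ⟩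
    1H *H Ti (x · s i)                       ≈⟨ *-idˡ _ ⟩
    Ti (x · s i)                             ∎

  T*Ti-up : ∀ x i → ¬ ℓ (x · s i) < ℓ x → T (s i) *H Ti x ≈ q • Ti (x · s i) +H (q -L 1L) • Ti x
  T*Ti-up x i xs≮x = begin
    T (s i) *H Ti x                                         ≈⟨ *-cong (T-s-via-Ti i) ≈-refl ⟩
    (q • Ti (s i) +H (q -L 1L) • 1H) *H Ti x                ≈⟨ distribʳ _ _ _ ⟩
    (q • Ti (s i)) *H Ti x +H ((q -L 1L) • 1H) *H Ti x      ≈⟨ +-cong (•-*ˡ _ _ _) (•-*ˡ _ _ _) ⟩
    q • (Ti (s i) *H Ti x) +H (q -L 1L) • (1H *H Ti x)      ≈⟨ +-cong (•-congʳ q (Ti-up x i xs≮x)) (•-congʳ (q -L 1L) (*-idˡ _)) ⟩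
    q • Ti (x · s i) +H (q -L 1L) • Ti x                    ∎

  Tword-snoc : ∀ L i → Tword (L ++ [ i ]) ≈ Tword L *H T (s i)
  Tword-snoc []      i = ≈-trans (*-idʳ _) (≈-sym (*-idˡ _))
  Tword-snoc (j ∷ L) i = ≈-trans (*-cong ≈-refl (Tword-snoc L i)) (≈-sym (*-assoc _ _ _))

  T*Tword : ∀ x L → ℓ (x · ⟦ L ⟧) ≡ ℓ x + length L → T x *H Tword L ≈ T (x · ⟦ L ⟧)
  T*Tword x []      _        = ≈-trans (*-idʳ (T x)) (≈-reflexive (cong T (sym (·-idʳ x))))
  T*Tword x (i ∷ L) additive = begin
    T x *H (T (s i) *H Tword L)   ≈⟨ *-assoc _ _ _ ⟨
    (T x *H T (s i)) *H Tword L   ≈⟨ *-cong (T-up x i xs≮x) ≈-refl ⟩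
    T (x · s i) *H Tword L        ≈⟨ T*Tword (x · s i) L (ℓ-additive-tail x i L additive) ⟩
    T (x · s i · ⟦ L ⟧)           ≡⟨ cong T (·-assoc x (s i) ⟦ L ⟧) ⟩
    T (x · (s i · ⟦ L ⟧))         ∎
    where
    xs≮x : ¬ ℓ (x · s i) < ℓ x
    xs≮x xs<x = ℕP.<-asym xs<x (subst (ℓ x <_) (sym (ℓ-additive-head x i L additive)) (ℕP.n<1+n (ℓ x)))

  Tword-reduced : ∀ L → Reduced L → Tword L ≈ T ⟦ L ⟧
  Tword-reduced L red = begin
    Tword L              ≈⟨ *-idˡ _ ⟨
    1H *H Tword L        ≈⟨ *-cong T-e ≈-refl ⟨
    T e *H Tword L       ≈⟨ T*Tword e L (trans (cong ℓ (·-idˡ ⟦ L ⟧)) (trans red (cong (_+ length L) (sym ℓ-e)))) ⟩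
    T (e · ⟦ L ⟧)        ≡⟨ cong T (·-idˡ ⟦ L ⟧) ⟩
    T ⟦ L ⟧              ∎

module TauMinusProperties
  (C : CoxeterSystem) (A : HeckeAlgebra C)
  (Ti : CoxeterSystem.W C → HeckeAlgebra.H A) (Ti-inverse : HeckeAlgebra.IsInverseFamily A Ti)
  (τ : HeckeAlgebra.H A → Laurent) (τ-minus : HeckeAlgebra.IsTauMinus A Ti τ)
  where
  open import Data.Nat using (_<_; _<?_)
  open CoxeterSystem C
  open HeckeAlgebra A
  open CoxeterSystemProperties C
  open HeckeAlgebraProperties C A Ti Ti-inverse
  open IsEquivalence ≈-equiv using () renaming (refl to ≈-refl; sym to ≈-sym; trans to ≈-trans; reflexive to ≈-reflexive)

  δₑ : W → Laurent
  δₑ w = if isE w then 1L else 0L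

  τ-cong : ∀ {x y} → x ≈ y → τ x ≈L τ y
  τ-cong = proj₁ τ-minus

  τ-+H : ∀ x y → τ (x +H y) ≈L τ x +L τ y
  τ-+H = proj₁ (proj₂ τ-minus)

  τ-• : ∀ a x → τ (a • x) ≈L a *L τ x
  τ-• = proj₁ (proj₂ (proj₂ τ-minus))

  τ-Ti : ∀ w → τ (Ti w) ≈L δₑ w
  τ-Ti = proj₂ (proj₂ (proj₂ τ-minus))

  δₑ-≢e : ∀ {x} → x ≢ e → δₑ x ≡ 0L
  δₑ-≢e x≢e rewrite isE-≢e x≢e = refl

  δₑ-rotate : ∀ x a y → δₑ ((x · a) · y) ≡ δₑ (a · (y · x))
  δₑ-rotate x a y = cong (λ b → if b then 1L else 0L) (begin
    isE ((x · a) · y)   ≡⟨ cong isE (·-assoc x a y) ⟩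
    isE (x · (a · y))   ≡⟨ isE-comm x (a · y) ⟩
    isE ((a · y) · x)   ≡⟨ cong isE (·-assoc a y x) ⟩
    isE (a · (y · x))   ∎)
    where open ≡-Reasoning

  τ-combination : ∀ Z a b x y → τ (Z *H (a • x +H b • y)) ≈L a *L τ (Z *H x) +L b *L τ (Z *H y)
  τ-combination Z a b x y = begin
    τ (Z *H (a • x +H b • y))              ≈⟨ τ-cong (distribˡ _ _ _) ⟩
    τ (Z *H (a • x) +H Z *H (b • y))       ≈⟨ τ-cong (+-cong (•-*ʳ _ _ _) (•-*ʳ _ _ _)) ⟩
    τ (a • (Z *H x) +H b • (Z *H y))       ≈⟨ τ-+H _ _ ⟩
    τ (a • (Z *H x)) +L τ (b • (Z *H y))   ≈⟨ +L-cong (τ-• a _) (τ-• b _) ⟩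
    a *L τ (Z *H x) +L b *L τ (Z *H y)     ∎
    where open ≈L-Reasoning

  DualityAt : List (Fin r) → Set
  DualityAt L = ∀ y → τ ((q^ (length L) • Ti ⟦ L ⟧) *H Ti y) ≈L δₑ (⟦ L ⟧ · y)

  module DualityStep (j : Fin r) (L : List (Fin r)) (red : Reduced (j ∷ L)) (ih : DualityAt L) where
    a : W
    a = ⟦ L ⟧

    Z : H
    Z = q^ (length L) • Ti a

    ℓ-s·a : ℓ (s j · a) ≡ suc (ℓ a)
    ℓ-s·a = trans red (cong suc (sym (Reduced-tail j L red)))

    split-first-letter : ∀ h → (q^ (suc (length L)) • Ti (s j · a)) *H h ≈ q • (Z *H (Ti (s j) *H h))
    split-first-letter h = begin
      (q^ (suc (length L)) • Ti (s j · a)) *H h                 ≈⟨ *-cong (•-congʳ _ Ti-s·a) ≈-refl ⟩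
      ((q *L q^ (length L)) • (Ti a *H Ti (s j))) *H h          ≈⟨ *-cong (•-assoc _ _ _) ≈-refl ⟩
      (q • (q^ (length L) • (Ti a *H Ti (s j)))) *H h           ≈⟨ •-*ˡ _ _ _ ⟩
      q • ((q^ (length L) • (Ti a *H Ti (s j))) *H h)           ≈⟨ •-congʳ q (*-cong (•-*ˡ _ _ _) ≈-refl) ⟨
      q • ((Z *H Ti (s j)) *H h)                                ≈⟨ •-congʳ q (*-assoc _ _ _) ⟩
      q • (Z *H (Ti (s j) *H h))                                ∎
      where
      open ≈H-Reasoning
      Ti-s·a : Ti (s j · a) ≈ Ti a *H Ti (s j)
      Ti-s·a = Ti-anti-homo (≈-trans (*-cong ≈-refl (≈-sym (Tword-reduced L (Reduced-tail j L red)))) (Tword-reduced (j ∷ L) red))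

    up : ∀ y → ¬ ℓ (y · s j) < ℓ y → τ ((q^ (suc (length L)) • Ti (s j · a)) *H Ti y) ≈L δₑ (s j · a · y)
    up y ys≮y = begin
      τ ((q^ (suc (length L)) • Ti (s j · a)) *H Ti y)  ≈⟨ τ-cong (split-first-letter (Ti y)) ⟩
      τ (q • (Z *H (Ti (s j) *H Ti y)))                 ≈⟨ τ-cong (•-congʳ q (*-cong ≈-refl (Ti-up y j ys≮y))) ⟩
      τ (q • (Z *H Ti (y · s j)))                       ≈⟨ τ-• q _ ⟩
      q *L τ (Z *H Ti (y · s j))                        ≈⟨ *L-congˡ q (ih (y · s j)) ⟩
      q *L δₑ (a · (y · s j))                           ≡⟨ cong (q *L_) (δₑ-≢e a·ys≢e) ⟩
      q *L 0L                                           ≈⟨ *L-zeroʳ q ⟩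
      0L                                                ≡⟨ δₑ-≢e a·ys≢e ⟨
      δₑ (a · (y · s j))                                ≡⟨ δₑ-rotate (s j) a y ⟨
      δₑ (s j · a · y)                                  ∎
      where
      open ≈L-Reasoning
      a·ys≢e : a · (y · s j) ≢ e
      a·ys≢e a·ys≡e = ys≮y (subst (λ t → ℓ (y · s j) < ℓ t) (·s·s y j)
                                  (ℕP.≤-reflexive (sym (ℓ-·s-of-inverse ℓ-s·a a·ys≡e))))

    down : ∀ y → ℓ (y · s j) < ℓ y → τ ((q^ (suc (length L)) • Ti (s j · a)) *H Ti y) ≈L δₑ (s j · a · y)
    down y ys<y = begin
      τ ((q^ (suc (length L)) • Ti (s j · a)) *H Ti y)                  ≈⟨ τ-cong (split-first-letter (Ti y)) ⟩
      τ (q • (Z *H (Ti (s j) *H Ti y)))                                 ≈⟨ τ-• q _ ⟩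
      q *L τ (Z *H (Ti (s j) *H Ti y))                                  ≈⟨ +L-identityʳ _ ⟨
      q *L τ (Z *H (Ti (s j) *H Ti y)) +L 0L                            ≈⟨ +L-cong (λ _ → refl) (*L-zeroʳ (q -L 1L)) ⟨
      q *L τ (Z *H (Ti (s j) *H Ti y)) +L (q -L 1L) *L 0L               ≡⟨ cong (λ t → q *L τ (Z *H (Ti (s j) *H Ti y)) +L (q -L 1L) *L t) (δₑ-≢e a·y≢e) ⟨
      q *L τ (Z *H (Ti (s j) *H Ti y)) +L (q -L 1L) *L δₑ (a · y)       ≈⟨ +L-cong (λ _ → refl) (*L-congˡ (q -L 1L) (ih y)) ⟨
      q *L τ (Z *H (Ti (s j) *H Ti y)) +L (q -L 1L) *L τ (Z *H Ti y)    ≈⟨ τ-combination Z q (q -L 1L) _ _ ⟨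
      τ (Z *H (q • (Ti (s j) *H Ti y) +H (q -L 1L) • Ti y))             ≈⟨ τ-cong (*-cong ≈-refl (Ti-down-expand y j ys<y)) ⟨
      τ (Z *H Ti (y · s j))                                             ≈⟨ ih (y · s j) ⟩
      δₑ (a · (y · s j))                                                ≡⟨ δₑ-rotate (s j) a y ⟨
      δₑ (s j · a · y)                                                  ∎
      where
      open ≈L-Reasoning
      a·y≢e : a · y ≢ e
      a·y≢e a·y≡e = ℕP.<-asym ys<y (ℕP.≤-reflexive (sym (ℓ-·s-of-inverse ℓ-s·a a·y≡e)))

  τ-dual-reduced : ∀ L → Reduced L → DualityAt L
  τ-dual-reduced [] _ y = begin
    τ ((q^ 0 • Ti e) *H Ti y)  ≈⟨ τ-cong (≈-trans (*-cong (≈-trans (•-one _) Ti-e) ≈-refl) (*-idˡ _)) ⟩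
    τ (Ti y)                   ≈⟨ τ-Ti y ⟩
    δₑ y                       ≡⟨ cong δₑ (·-idˡ y) ⟨
    δₑ (e · y)                 ∎
    where open ≈L-Reasoning
  τ-dual-reduced (j ∷ L) red y with ℓ (y · s j) <? ℓ y
  ... | no  ys≮y = DualityStep.up   j L red (τ-dual-reduced L (Reduced-tail j L red)) y ys≮y
  ... | yes ys<y = DualityStep.down j L red (τ-dual-reduced L (Reduced-tail j L red)) y ys<y

  τ-dual : ∀ x y → τ ((q^ (ℓ x) • Ti x) *H Ti y) ≈L δₑ (x · y)
  τ-dual x y with ℓ-word x
  ... | L , |L|≡ℓx , refl rewrite sym |L|≡ℓx = τ-dual-reduced L (sym |L|≡ℓx) y

  module _ (v : W) where
    prefix : List (Fin r) → H
    prefix L = (q^ (ℓ v) • Ti (v ⁻¹)) *H Tword L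

    prefix-reverse-∷ : ∀ i ρ h → prefix (reverse (i ∷ ρ)) *H h ≈ prefix (reverse ρ) *H (T (s i) *H h)
    prefix-reverse-∷ i ρ h = begin
      prefix (reverse (i ∷ ρ)) *H h                                   ≡⟨ cong (λ L → prefix L *H h) (ListP.unfold-reverse i ρ) ⟩
      prefix (reverse ρ ++ [ i ]) *H h                                ≈⟨ *-cong (*-cong ≈-refl (Tword-snoc (reverse ρ) i)) ≈-refl ⟩
      ((q^ (ℓ v) • Ti (v ⁻¹)) *H (Tword (reverse ρ) *H T (s i))) *H h ≈⟨ *-cong (*-assoc _ _ _) ≈-refl ⟨
      (prefix (reverse ρ) *H T (s i)) *H h                            ≈⟨ *-assoc _ _ _ ⟩
      prefix (reverse ρ) *H (T (s i) *H h)                            ∎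
      where open ≈H-Reasoning

    Rrev-via-τ : ∀ ρ u → Rrev C v u ρ ≈L τ (prefix (reverse ρ) *H Ti (v · u))
    Rrev-via-τ [] u = begin
      δₑ u                                            ≡⟨ cong δₑ (⁻¹-cancelˡ v u) ⟨
      δₑ (v ⁻¹ · (v · u))                             ≈⟨ τ-dual (v ⁻¹) (v · u) ⟨
      τ ((q^ (ℓ (v ⁻¹)) • Ti (v ⁻¹)) *H Ti (v · u))   ≡⟨ cong (λ k → τ ((q^ k • Ti (v ⁻¹)) *H Ti (v · u))) (ℓ-⁻¹ v) ⟩
      τ ((q^ (ℓ v) • Ti (v ⁻¹)) *H Ti (v · u))        ≈⟨ τ-cong (*-cong (*-idʳ _) ≈-refl) ⟨
      τ (prefix [] *H Ti (v · u))                     ∎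
      where open ≈L-Reasoning
    Rrev-via-τ (i ∷ ρ) u with ℓ (v · u · s i) <? ℓ (v · u)
    ... | yes vus<vu = begin
      Rrev C v (u · s i) ρ                              ≈⟨ Rrev-via-τ ρ (u · s i) ⟩
      τ (prefix (reverse ρ) *H Ti (v · (u · s i)))      ≡⟨ cong (λ t → τ (prefix (reverse ρ) *H Ti t)) (·-assoc v u (s i)) ⟨
      τ (prefix (reverse ρ) *H Ti (v · u · s i))        ≈⟨ τ-cong (*-cong ≈-refl (T*Ti-down (v · u) i vus<vu)) ⟨
      τ (prefix (reverse ρ) *H (T (s i) *H Ti (v · u))) ≈⟨ τ-cong (prefix-reverse-∷ i ρ _) ⟨
      τ (prefix (reverse (i ∷ ρ)) *H Ti (v · u))        ∎
      where open ≈L-Reasoning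
    ... | no vus≮vu = begin
      q *L Rrev C v (u · s i) ρ +L (q -L 1L) *L Rrev C v u ρ
        ≈⟨ +L-cong (*L-congˡ q (Rrev-via-τ ρ (u · s i))) (*L-congˡ (q -L 1L) (Rrev-via-τ ρ u)) ⟩
      q *L τ (P *H Ti (v · (u · s i))) +L (q -L 1L) *L τ (P *H Ti (v · u))
        ≈⟨ τ-combination P q (q -L 1L) _ _ ⟨
      τ (P *H (q • Ti (v · (u · s i)) +H (q -L 1L) • Ti (v · u)))
        ≡⟨ cong (λ t → τ (P *H (q • Ti t +H (q -L 1L) • Ti (v · u)))) (·-assoc v u (s i)) ⟨
      τ (P *H (q • Ti (v · u · s i) +H (q -L 1L) • Ti (v · u)))
        ≈⟨ τ-cong (*-cong ≈-refl (T*Ti-up (v · u) i vus≮vu)) ⟨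
      τ (P *H (T (s i) *H Ti (v · u)))
        ≈⟨ τ-cong (prefix-reverse-∷ i ρ _) ⟨
      τ (prefix (reverse (i ∷ ρ)) *H Ti (v · u))
        ∎
      where
      open ≈L-Reasoning
      P : H
      P = prefix (reverse ρ)

    prefix-*H : ∀ L h → prefix L *H h ≈ q^ (ℓ v) • (Ti (v ⁻¹) *H Tword L *H h)
    prefix-*H L h = ≈-trans (*-cong (•-*ˡ _ _ _) ≈-refl) (•-*ˡ _ _ _)

    Rpoly-via-τ : ∀ u w → Rpoly C v u w ≈L τ (prefix w *H Ti (v · u))
    Rpoly-via-τ u w = begin
      Rrev C v u (reverse w)                           ≈⟨ Rrev-via-τ (reverse w) u ⟩
      τ (prefix (reverse (reverse w)) *H Ti (v · u))   ≡⟨ cong (λ L → τ (prefix L *H Ti (v · u))) (ListP.reverse-involutive w) ⟩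
      τ (prefix w *H Ti (v · u))                       ∎
      where open ≈L-Reasoning

corollary5p3 : (C : CoxeterSystem) (A : HeckeAlgebra C) →
    let open CoxeterSystem C
        open HeckeAlgebra A
    in (Ti : W → H) → IsInverseFamily Ti →
       (τ : H → Laurent) → IsTauMinus Ti τ →
       (w : List (Fin r)) (u v : W) →
       Rpoly C v u w ≈L q^ (ℓ v) *L τ (Ti (v ⁻¹) *H Tword w *H Ti (v · u))
corollary5p3 C A Ti Ti-inverse τ τ-minus w u v = begin
  Rpoly C v u w                                        ≈⟨ Rpoly-via-τ v u w ⟩
  τ (prefix v w *H Ti (v · u))                         ≈⟨ τ-cong (prefix-*H v w (Ti (v · u))) ⟩
  τ (q^ (ℓ v) • (Ti (v ⁻¹) *H Tword w *H Ti (v · u)))  ≈⟨ τ-• (q^ (ℓ v)) _ ⟩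
  q^ (ℓ v) *L τ (Ti (v ⁻¹) *H Tword w *H Ti (v · u))   ∎
  where
  open CoxeterSystem C
  open HeckeAlgebra A
  open TauMinusProperties C A Ti Ti-inverse τ τ-minus
  open ≈L-Reasoning
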